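{- Let $A$ be a commutative ring with identity and $HA$ the ring of Hurwitz series over $A$. Let $n\in\mathbb{N}^+$ be fixed and let $z_0,z_1,\dots,z_{n-1}\in HA$. For every $k\in\mathbb{N}$ write $\widehat{k}=\lfloor k/n\rfloor$ and $\overline{k}=k-\widehat{k}n$. Then for all $k\in\mathbb{N}$, $$\langle k\rangle\cdot \mathrm{intl}(z_0,\dots,z_{n-1})=\mathrm{intl}\Big(\int^{\widehat{k}+1}C^{n-\overline{k}+k}_{k,n}\boxdot z_{n-\overline{k}},\ \dots,\ \int^{\widehat{k}+1}C^{n-1+k}_{k,n}\boxdot z_{n-1},\ \int^{\widehat{k}}C^{k}_{k,n}\boxdot z_0,\ \dots,\ \int^{\widehat{k}}C^{n-\overline{k}-1+k}_{k,n}\boxdot z_{n-\overline{k}-1}\Big),$$ i.e. the $j$-th argument ($0\le j\le n-1$) of the interlacing on the right is $\int^{\widehat{k}+1}C^{n-\overline{k}+j+k}_{k,n}\boxdot z_{n-\overline{k}+j}$ if $j<\overline{k}$ and $\int^{\widehat{k}}C^{j-\overline{k}+k}_{k,n}\boxdot z_{j-\overline{k}}$ if $j\ge\overline{k}$.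
   Context: $HA$ is the set of sequences $f=(f(0),f(1),\dots)$ with entries in $A$, with componentwise addition and product $(fg)(m)=\sum_{i=0}^m\binom{m}{i}f(i)g(m-i)$. The integral is $\int f=(0,f(0),f(1),\dots)$ and $\int^m$ denotes its $m$-fold iterate ($\int^0=\mathrm{id}$). For $m\in\mathbb{N}$, $\langle m\rangle\in HA$ is the sequence with $\langle m\rangle(i)=\delta_{i,m}$. For fixed $n\in\mathbb{N}^+$ and $m\in\mathbb{N}$, $\widehat{m}=\lfloor m/n\rfloor$, $\overline{m}=m-\widehat{m}n$. The interlacing of $z_0,\dots,z_{n-1}\in HA$ is the element $\mathrm{intl}(z_0,\dots,z_{n-1})\in HA$ given by $\mathrm{intl}(z_0,\dots,z_{n-1})(m)=z_{\overline{m}}(\widehat{m})$, i.e. $(z_0(0),\dots,z_{n-1}(0),z_0(1),\dots,z_{n-1}(1),\dots)$. The Hadamard product is $(f\boxdot g)(p)=f(p)g(p)$. For $\ell,k\in\mathbb{N}$, $C^{\ell}_{k,n}\in HA$ is defined by $C^{\ell}_{k,n}(p)=\binom{\ell+pn}{k}$ for all $p\in\mathbb{N}$ (with $\binom{a}{b}=0$ if $a<b$). -}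

module Defs where

open import Level using (Level)
open import Data.Nat using (ℕ; zero; suc; _+_; _*_; _∸_; _<_; NonZero)
open import Data.Nat.DivMod using (_/_; _%_; m%n<n)
import Data.Nat.Properties
import Data.Fin.Properties
open import Data.Nat.Combinatorics using (_C_)
open import Data.Fin using (Fin; toℕ; fromℕ<)
open import Algebra.Bundles using (CommutativeRing)
open import Relation.Nullary using (yes; no)
open import Data.Nat using (_<?_)
open import Relation.Binary.PropositionalEquality using (_≡_)

module Hurwitz {c ℓ : Level} (A : CommutativeRing c ℓ) where
  open CommutativeRing A using (Carrier; _≈_; 0#; 1#) renaming (_+_ to _+A_; _*_ to _*A_)

  HA : Set c
  HA = ℕ → Carrier

  infix 4 _≈H_
  _≈H_ : HA → HA → Set ℓ
  f ≈H g = ∀ m → f m ≈ g m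

  _·ℕ_ : ℕ → Carrier → Carrier
  zero  ·ℕ a = 0#
  suc m ·ℕ a = a +A (m ·ℕ a)

  sumTo : ℕ → (ℕ → Carrier) → Carrier
  sumTo zero    s = s 0
  sumTo (suc m) s = sumTo m s +A s (suc m)

  _⊙_ : HA → HA → HA
  (f ⊙ g) m = sumTo m (λ i → (m C i) ·ℕ (f i *A g (m ∸ i)))

  ∫ : HA → HA
  ∫ f zero    = 0#
  ∫ f (suc m) = f m

  ∫^ : ℕ → HA → HA
  ∫^ zero    f = f
  ∫^ (suc m) f = ∫ (∫^ m f)

  ⟨_⟩ : ℕ → HA
  ⟨ m ⟩ i with i Data.Nat.≟ m
  ... | yes _ = 1#
  ... | no  _ = 0#

  _⊡_ : HA → HA → HA
  (f ⊡ g) p = f p *A g p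

  Cs : (l k n : ℕ) → HA
  Cs l k n p = ((l + p * n) C k) ·ℕ 1#

  intl : (n : ℕ) .{{_ : NonZero n}} → (Fin n → HA) → HA
  intl n z m = z (fromℕ< (m%n<n m n)) (m / n)

  -- the j-th argument of the interlacing on the right-hand side of Thm 3.10,
  -- where kh = ⌊k/n⌋ and kb = k - kh n  (passed with proof kb < n)
  private
    idx₁ : ∀ {n kb j} → kb < n → j < kb → n ∸ kb + j < n
    idx₁ {n} {kb} {j} kb<n j<kb = Data.Nat.Properties.≤-trans
      (Data.Nat.Properties.+-monoʳ-< (n ∸ kb) j<kb)
      (Data.Nat.Properties.≤-reflexive (Data.Nat.Properties.m∸n+n≡m (Data.Nat.Properties.<⇒≤ kb<n)))
    idx₂ : ∀ {n kb} (j : Fin n) → toℕ j ∸ kb < n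
    idx₂ {n} {kb} j = Data.Nat.Properties.≤-<-trans
      (Data.Nat.Properties.m∸n≤m (toℕ j) kb) (Data.Fin.Properties.toℕ<n j)

  rhsArg : (n : ℕ) (z : Fin n → HA) (k kh kb : ℕ) → kb < n → Fin n → HA
  rhsArg n z k kh kb kb<n j with toℕ j <? kb
  ... | yes j<kb = ∫^ (suc kh) (Cs (n ∸ kb + toℕ j + k) k n ⊡ z (fromℕ< (idx₁ kb<n j<kb)))
  ... | no  _    = ∫^ kh (Cs (toℕ j ∸ kb + k) k n ⊡ z (fromℕ< (idx₂ {kb = kb} j)))

-- Multiplying by ⟨k⟩ multiplies the m-th entry by binom(m,k) and shifts the sequence k places to
-- the right.  In an interlacing, z_i(q) sits at position i + q n; shifted by k it lands at
-- position j + (a + q) n, where j + a n = i + k, i.e. (j, a) = (i + k̄ - n, k̂ + 1) if i + k̄ ≥ n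
-- and (i + k̄, k̂) otherwise.  Hence the j-th component of the product is z_i delayed by a
-- (that is, ∫^a) and weighted by binom(i + k + q n, k) = C^{i+k}_{k,n}(q).

module Submission where

open import Defs
open import Level using (Level)
open import Data.Nat using (ℕ; NonZero)
open import Data.Nat.DivMod using (_/_; _%_; m%n<n)
open import Data.Fin using (Fin)
open import Algebra.Bundles using (CommutativeRing)

open import Data.Nat using (zero; suc; _+_; _*_; _∸_; _≤_; _<_; s≤s; s≤s⁻¹; _≟_; _<?_)
open import Data.Nat.Properties
open import Data.Nat.DivMod using (m≡m%n+[m/n]*n; [m+kn]%n≡m%n; m<n⇒m%n≡m; +-distrib-/-∣ʳ; m<n⇒m/n≡0; m*n/n≡m)
open import Data.Nat.Divisibility using (n∣m*n)
open import Data.Nat.Tactic.RingSolver using (solve)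
open import Data.Nat.Combinatorics using (_C_)
open import Data.Fin using (toℕ; fromℕ<)
open import Data.Fin.Properties using (toℕ-fromℕ<; toℕ-injective; toℕ<n)
open import Data.Product using (_,_)
open import Data.List using (_∷_; [])
open import Data.Empty using (⊥-elim)
open import Relation.Nullary using (yes; no)
open import Relation.Binary.PropositionalEquality
  using (_≡_; _≢_; refl; sym; trans; cong; cong₂; module ≡-Reasoning)
import Algebra.Properties.Semiring.Mult as SemiringMult
import Relation.Binary.Reasoning.Setoid as SetoidReasoning

shift-position-< : ∀ {n i L} j k a p → i < n → i + k ≡ L → j + a * n ≡ L → p < a → j + p * n < k
shift-position-< {n} {i} j k a p i<n i+k≡L j+an≡L p<a = +-cancelˡ-< n _ _ (begin-strict
  n + (j + p * n)  ≡⟨ solve (n ∷ j ∷ p ∷ []) ⟩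
  j + suc p * n    ≤⟨ +-monoʳ-≤ j (*-monoˡ-≤ n p<a) ⟩
  j + a * n        ≡⟨ trans j+an≡L (sym i+k≡L) ⟩
  i + k            <⟨ +-monoˡ-< k i<n ⟩
  n + k            ∎)
  where open ≤-Reasoning

position-+-rows : ∀ {n L} j a q → j + a * n ≡ L → j + (a + q) * n ≡ L + q * n
position-+-rows {n} j a q refl = solve (j ∷ a ∷ q ∷ n ∷ [])

shifted-position-+-rows : ∀ {n L} i k q → i + k ≡ L → (i + q * n) + k ≡ L + q * n
shifted-position-+-rows {n} i k q refl = solve (i ∷ q ∷ n ∷ k ∷ [])

wrapped-position : ∀ {n kb} j kh → kb ≤ n → j + suc kh * n ≡ n ∸ kb + j + (kb + kh * n)
wrapped-position {n} {kb} j kh kb≤n = begin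
  j + (n + kh * n)                     ≡⟨ cong (λ m → j + (m + kh * n)) (sym (m∸n+n≡m kb≤n)) ⟩
  j + ((n ∸ kb + kb) + kh * n)         ≡⟨ rearrange (n ∸ kb) (kh * n) ⟩
  n ∸ kb + j + (kb + kh * n)           ∎
  where
  open ≡-Reasoning
  rearrange : ∀ d x → j + ((d + kb) + x) ≡ d + j + (kb + x)
  rearrange d x = solve (j ∷ d ∷ kb ∷ x ∷ [])

unwrapped-position : ∀ {n kb} j kh → kb ≤ j → j + kh * n ≡ j ∸ kb + (kb + kh * n)
unwrapped-position {n} {kb} j kh kb≤j = begin
  j + kh * n                ≡⟨ cong (_+ kh * n) (sym (m∸n+n≡m kb≤j)) ⟩
  (j ∸ kb + kb) + kh * n    ≡⟨ +-assoc (j ∸ kb) kb (kh * n) ⟩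
  j ∸ kb + (kb + kh * n)    ∎
  where open ≡-Reasoning

[m+kn]/n≡k : ∀ {m n} .{{_ : NonZero n}} k → m < n → (m + k * n) / n ≡ k
[m+kn]/n≡k {m} {n} k m<n = begin
  (m + k * n) / n    ≡⟨ +-distrib-/-∣ʳ m (n∣m*n k) ⟩
  m / n + k * n / n  ≡⟨ cong₂ _+_ (m<n⇒m/n≡0 m<n) (m*n/n≡m k n) ⟩
  k                  ∎
  where open ≡-Reasoning

module HurwitzProperties {c ℓ : Level} (A : CommutativeRing c ℓ) where
  open Hurwitz A
  open CommutativeRing A
    using (Carrier; _≈_; 0#; 1#; setoid; semiring; zeroˡ; +-cong; +-congʳ)
    renaming (_+_ to _+ᴬ_; _*_ to _*ᴬ_; +-identityˡ to +ᴬ-identityˡ; +-identityʳ to +ᴬ-identityʳ; refl to ≈-refl)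
  open SemiringMult semiring using (_×_; ×-comm-*; ×-assoc-*)
  open SetoidReasoning setoid

  ·ℕ≗× : ∀ m x → m ·ℕ x ≡ m × x
  ·ℕ≗× zero    x = refl
  ·ℕ≗× (suc m) x = cong (x +ᴬ_) (·ℕ≗× m x)

  ·ℕ-zeroˡ-* : ∀ m y → m ·ℕ (0# *ᴬ y) ≈ 0#
  ·ℕ-zeroˡ-* m y = begin
    m ·ℕ (0# *ᴬ y)  ≡⟨ ·ℕ≗× m (0# *ᴬ y) ⟩
    m × (0# *ᴬ y)   ≈⟨ ×-comm-* m 0# y ⟨
    0# *ᴬ (m × y)   ≈⟨ zeroˡ (m × y) ⟩
    0#              ∎

  ·ℕ-assoc-* : ∀ m x y → (m ·ℕ x) *ᴬ y ≈ m ·ℕ (x *ᴬ y)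
  ·ℕ-assoc-* m x y = begin
    (m ·ℕ x) *ᴬ y  ≡⟨ cong (_*ᴬ y) (·ℕ≗× m x) ⟩
    (m × x) *ᴬ y   ≈⟨ ×-assoc-* m x y ⟩
    m × (x *ᴬ y)   ≡⟨ ·ℕ≗× m (x *ᴬ y) ⟨
    m ·ℕ (x *ᴬ y)  ∎

  sumTo-below : ∀ {s k} → (∀ i → i ≢ k → s i ≈ 0#) → ∀ m → m < k → sumTo m s ≈ 0#
  sumTo-below s-vanishes zero    0<k   = s-vanishes 0 (<⇒≢ 0<k)
  sumTo-below {s} s-vanishes (suc m) 1+m<k = begin
    sumTo m s +ᴬ s (suc m)  ≈⟨ +-cong (sumTo-below s-vanishes m (<-trans (n<1+n m) 1+m<k))
                                      (s-vanishes (suc m) (<⇒≢ 1+m<k)) ⟩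
    0# +ᴬ 0#                ≈⟨ +ᴬ-identityˡ 0# ⟩
    0#                      ∎

  sumTo-from : ∀ {s} k → (∀ i → i ≢ k → s i ≈ 0#) → ∀ r → sumTo (r + k) s ≈ s k
  sumTo-from zero        s-vanishes zero    = ≈-refl
  sumTo-from {s} (suc k) s-vanishes zero    = begin
    sumTo k s +ᴬ s (suc k)  ≈⟨ +-congʳ (sumTo-below s-vanishes k (n<1+n k)) ⟩
    0# +ᴬ s (suc k)         ≈⟨ +ᴬ-identityˡ (s (suc k)) ⟩
    s (suc k)               ∎
  sumTo-from {s} k s-vanishes (suc r) = begin
    sumTo (r + k) s +ᴬ s (suc (r + k))  ≈⟨ +-cong (sumTo-from k s-vanishes r) (s-vanishes _ (>⇒≢ (s≤s (m≤n+m k r)))) ⟩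
    s k +ᴬ 0#                           ≈⟨ +ᴬ-identityʳ (s k) ⟩
    s k                                 ∎

  ⟨⟩-off : ∀ k i → i ≢ k → ⟨ k ⟩ i ≡ 0#
  ⟨⟩-off k i i≢k with i ≟ k
  ... | yes i≡k = ⊥-elim (i≢k i≡k)
  ... | no  _   = refl

  ⟨⟩-diag : ∀ k → ⟨ k ⟩ k ≡ 1#
  ⟨⟩-diag k with k ≟ k
  ... | yes _   = refl
  ... | no  k≢k = ⊥-elim (k≢k refl)

  ⟨⟩-⊙-term-off : ∀ k (g : HA) m i → i ≢ k → (m C i) ·ℕ (⟨ k ⟩ i *ᴬ g (m ∸ i)) ≈ 0#
  ⟨⟩-⊙-term-off k g m i i≢k = begin
    (m C i) ·ℕ (⟨ k ⟩ i *ᴬ g (m ∸ i))  ≡⟨ cong (λ x → (m C i) ·ℕ (x *ᴬ g (m ∸ i))) (⟨⟩-off k i i≢k) ⟩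
    (m C i) ·ℕ (0# *ᴬ g (m ∸ i))       ≈⟨ ·ℕ-zeroˡ-* (m C i) (g (m ∸ i)) ⟩
    0#                                 ∎

  ⟨⟩-⊙-below : ∀ k (g : HA) m → m < k → (⟨ k ⟩ ⊙ g) m ≈ 0#
  ⟨⟩-⊙-below k g m = sumTo-below (⟨⟩-⊙-term-off k g m) m

  ⟨⟩-⊙-shift : ∀ k (g : HA) r → (⟨ k ⟩ ⊙ g) (r + k) ≈ (((r + k) C k) ·ℕ 1#) *ᴬ g r
  ⟨⟩-⊙-shift k g r = begin
    (⟨ k ⟩ ⊙ g) (r + k)                         ≈⟨ sumTo-from k (⟨⟩-⊙-term-off k g (r + k)) r ⟩
    ((r + k) C k) ·ℕ (⟨ k ⟩ k *ᴬ g (r + k ∸ k)) ≡⟨ cong₂ (λ x y → ((r + k) C k) ·ℕ (x *ᴬ g y)) (⟨⟩-diag k) (m+n∸n≡m r k) ⟩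
    ((r + k) C k) ·ℕ (1# *ᴬ g r)                ≈⟨ ·ℕ-assoc-* ((r + k) C k) 1# (g r) ⟨
    (((r + k) C k) ·ℕ 1#) *ᴬ g r                ∎

  ∫^-below : ∀ a f p → p < a → ∫^ a f p ≡ 0#
  ∫^-below (suc a) f zero    _   = refl
  ∫^-below (suc a) f (suc p) p<a = ∫^-below a f p (s≤s⁻¹ p<a)

  ∫^-from : ∀ a f q → ∫^ a f (a + q) ≡ f q
  ∫^-from zero    f q = refl
  ∫^-from (suc a) f q = ∫^-from a f q

  intl-at : ∀ n .{{_ : NonZero n}} (z : Fin n → HA) (i : Fin n) q → intl n z (toℕ i + q * n) ≡ z i q
  intl-at n z i q = cong₂ z (toℕ-injective (trans (toℕ-fromℕ< _) remainder)) ([m+kn]/n≡k q (toℕ<n i))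
    where
    remainder : (toℕ i + q * n) % n ≡ toℕ i
    remainder = trans ([m+kn]%n≡m%n (toℕ i) q n) (m<n⇒m%n≡m (toℕ<n i))

  ⟨⟩-⊙-intl-shift : ∀ n .{{_ : NonZero n}} (z : Fin n → HA) k (i j : Fin n) a L → toℕ i + k ≡ L →
                    toℕ j + a * n ≡ L → ∀ p → (⟨ k ⟩ ⊙ intl n z) (toℕ j + p * n) ≈ ∫^ a (Cs L k n ⊡ z i) p
  ⟨⟩-⊙-intl-shift n z k i j a L i+k≡L j+an≡L p with p <? a
  ... | yes p<a = begin
    (⟨ k ⟩ ⊙ intl n z) (toℕ j + p * n)  ≈⟨ ⟨⟩-⊙-below k (intl n z) _ (shift-position-< (toℕ j) k a p (toℕ<n i) i+k≡L j+an≡L p<a) ⟩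
    0#                                 ≡⟨ ∫^-below a _ p p<a ⟨
    ∫^ a (Cs L k n ⊡ z i) p            ∎
  ... | no p≮a with m≤n⇒∃[o]m+o≡n (≮⇒≥ p≮a)
  ...   | q , refl = begin
    (⟨ k ⟩ ⊙ intl n z) (toℕ j + (a + q) * n)  ≡⟨ cong (⟨ k ⟩ ⊙ intl n z) (trans (position-+-rows (toℕ j) a q j+an≡L) (sym r+k≡L+qn)) ⟩
    (⟨ k ⟩ ⊙ intl n z) (r + k)                ≈⟨ ⟨⟩-⊙-shift k (intl n z) r ⟩
    (((r + k) C k) ·ℕ 1#) *ᴬ intl n z r       ≡⟨ cong₂ (λ l x → ((l C k) ·ℕ 1#) *ᴬ x) r+k≡L+qn (intl-at n z i q) ⟩
    (Cs L k n ⊡ z i) q                        ≡⟨ ∫^-from a _ q ⟨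
    ∫^ a (Cs L k n ⊡ z i) (a + q)             ∎
    where
    r = toℕ i + q * n
    r+k≡L+qn : r + k ≡ L + q * n
    r+k≡L+qn = shifted-position-+-rows (toℕ i) k q i+k≡L

  ⟨⟩-⊙-intl-rhsArg : ∀ n .{{_ : NonZero n}} (z : Fin n → HA) k kh kb (kb<n : kb < n) → k ≡ kb + kh * n →
                     ∀ j p → (⟨ k ⟩ ⊙ intl n z) (toℕ j + p * n) ≈ rhsArg n z k kh kb kb<n j p
  ⟨⟩-⊙-intl-rhsArg n z k kh kb kb<n refl j with toℕ j <? kb
  ... | yes j<kb = ⟨⟩-⊙-intl-shift n z k (fromℕ< i<n) j (suc kh) _
                     (cong (_+ k) (toℕ-fromℕ< i<n)) (wrapped-position (toℕ j) kh (<⇒≤ kb<n))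
    where
    i<n : n ∸ kb + toℕ j < n
    i<n = ≤-trans (+-monoʳ-< (n ∸ kb) j<kb) (≤-reflexive (m∸n+n≡m (<⇒≤ kb<n)))
  ... | no j≮kb = ⟨⟩-⊙-intl-shift n z k (fromℕ< i<n) j kh _
                     (cong (_+ k) (toℕ-fromℕ< i<n)) (unwrapped-position (toℕ j) kh (≮⇒≥ j≮kb))
    where
    i<n : toℕ j ∸ kb < n
    i<n = ≤-<-trans (m∸n≤m (toℕ j) kb) (toℕ<n j)

theorem3p10 : ∀ {c ℓ : Level} (A : CommutativeRing c ℓ) (n : ℕ) .{{_ : NonZero n}}
    (z : Fin n → Hurwitz.HA A) (k : ℕ) →
    Hurwitz._≈H_ A (Hurwitz._⊙_ A (Hurwitz.⟨_⟩ A k) (Hurwitz.intl A n z))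
      (Hurwitz.intl A n (Hurwitz.rhsArg A n z k (k / n) (k % n) (m%n<n k n)))
theorem3p10 A n z k m = begin
  (⟨ k ⟩ ⊙ intl n z) m                     ≡⟨ cong (⟨ k ⟩ ⊙ intl n z) m≡j+pn ⟩
  (⟨ k ⟩ ⊙ intl n z) (toℕ j + (m / n) * n) ≈⟨ ⟨⟩-⊙-intl-rhsArg n z k (k / n) (k % n) (m%n<n k n) (m≡m%n+[m/n]*n k n) j (m / n) ⟩
  intl n (rhsArg n z k (k / n) (k % n) (m%n<n k n)) m ∎
  where
  open Hurwitz A
  open HurwitzProperties A
  open SetoidReasoning (CommutativeRing.setoid A)
  j = fromℕ< (m%n<n m n)
  m≡j+pn : m ≡ toℕ j + (m / n) * n
  m≡j+pn = trans (m≡m%n+[m/n]*n m n) (cong (_+ (m / n) * n) (sym (toℕ-fromℕ< (m%n<n m n))))
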